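{- Let $F'_{[a_1,b_1]}\bullet\cdots\bullet F'_{[a_t,b_t]}$ be a type-$\mathsf{BC}$ zig-zag network. Then at most one interval $[a_i,b_i]$ satisfies $a_i<0$, $b_i=\bar{a_i}$. Furthermore, such an interval is maximal or minimal (or both) in the poset $\preceq$ on $\{[a_1,b_1],\dots,[a_t,b_t]\}$.
   Context: $[\bar n,n]=\{ -n,\dots,-1,1,\dots,n\}$, $\bar a=-a$, $[h,l]=\{h,\dots,l\}\setminus\{0\}$. Type-A planar network on $[h,l]$: directed planar acyclic multigraph in a disc with boundary vertices labelled clockwise source $h,\dots,$ source $l$, sink $l,\dots,$ sink $h$; edges may carry positive integer multiplicities; sources have indegree 0, outdegree 1, sinks indegree 1, outdegree 0. For $[a,b]\subseteq[h,l]$, $F_{[a,b]}$ has an edge source $i\to$ sink $i$ for $i\notin[a,b]$ and one interior vertex $z$ with edges source $i\to z\to$ sink $i$ for $i\in[a,b]$ (no interior vertex if $a=b$). $E\bullet F$ (condensed concatenation): merge, for each $i$, the edge into sink $i$ of $E$ with the edge out of source $i$ of $F$, then replace each set of $m>1$ parallel edges by one edge of multiplicity $m$. Type-$\mathsf{BC}$ simple star networks on $[\bar n,n]$: $F'_{[a,b]}=F_{[a,b]}\bullet F_{[\bar b,\bar a]}$ for $1\le a\le b\le n$, and $F'_{[\bar a,a]}=F_{[\bar a,a]}$ for $1\le a\le n$. Intervals $[c_1,d_1],\dots,[c_t,d_t]$ satisfy the zig-zag conditions if distinct, pairwise non-nesting, and for all $i<j<k$ with $[c_i,d_i]\cap[c_j,d_j]\ne\emptyset\ne[c_j,d_j]\cap[c_k,d_k]$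 one has $c_i<c_j<c_k$ or $c_i>c_j>c_k$. A type-$\mathsf{BC}$ zig-zag network is $F'_{[c_1,d_1]}\bullet\cdots\bullet F'_{[c_t,d_t]}$ with intervals (each of the form $[a,b]$ with $1\le a\le b\le n$ or $[\bar a,a]$) satisfying the zig-zag conditions. The poset $\preceq$ on the intervals is the reflexive transitive closure of the relation $[c_i,d_i]\lessdot[c_j,d_j]$ holding when $i<j$ and $([c_i,d_i]\cap[c_j,d_j])\setminus([c_{i+1},d_{i+1}]\cup\cdots\cup[c_{j-1},d_{j-1}])\ne\emptyset$. -}

module Defs where

open import Data.Nat using (ℕ)
open import Data.Integer using (ℤ; +_; -_; _≤_; _<_; 0ℤ)
open import Data.Fin using (Fin) renaming (_<_ to _<ᶠ_)
open import Data.Product using (Σ; ∃; _×_; _,_; proj₁; proj₂)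
open import Data.Sum using (_⊎_)
open import Relation.Binary.PropositionalEquality using (_≡_; _≢_)
open import Relation.Binary.Construct.Closure.ReflexiveTransitive using (Star)
open import Relation.Nullary using (¬_)

-- An interval [c,d] of nonzero integers, stored by its endpoints (c , d).
Interval : Set
Interval = ℤ × ℤ

_∈ᴵ_ : ℤ → Interval → Set
x ∈ᴵ (c , d) = (x ≢ 0ℤ) × (c ≤ x) × (x ≤ d)

Meets : Interval → Interval → Set
Meets I J = ∃ λ x → (x ∈ᴵ I) × (x ∈ᴵ J)

_⊆ᴵ_ : Interval → Interval → Set
I ⊆ᴵ J = ∀ x → x ∈ᴵ I → x ∈ᴵ J

BCInterval : ℕ → Interval → Set
BCInterval n I =
  (∃ λ a → ∃ λ b → (+ 1 ≤ a) × (a ≤ b) × (b ≤ + n) × (I ≡ (a , b)))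
  ⊎ (∃ λ a → (+ 1 ≤ a) × (a ≤ + n) × (I ≡ (- a , a)))

ZigZag : {t : ℕ} → (Fin t → Interval) → Set
ZigZag {t} I =
  (∀ i j → I i ≡ I j → i ≡ j)
  × (∀ i j → i ≢ j → ¬ (I i ⊆ᴵ I j))
  × (∀ i j k → i <ᶠ j → j <ᶠ k → Meets (I i) (I j) → Meets (I j) (I k) →
       ((proj₁ (I i) < proj₁ (I j)) × (proj₁ (I j) < proj₁ (I k)))
       ⊎ ((proj₁ (I j) < proj₁ (I i)) × (proj₁ (I k) < proj₁ (I j))))

-- A type-BC zig-zag network F'_{I 1} • ⋯ • F'_{I t} on [n̄,n]
-- is determined by its sequence of intervals.
BCZigZag : (n : ℕ) {t : ℕ} → (Fin t → Interval) → Set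
BCZigZag n I = (∀ i → BCInterval n (I i)) × ZigZag I

Cover : {t : ℕ} → (Fin t → Interval) → Fin t → Fin t → Set
Cover I i j = (i <ᶠ j) × ∃ λ x → (x ∈ᴵ I i) × (x ∈ᴵ I j) ×
  (∀ k → i <ᶠ k → k <ᶠ j → ¬ (x ∈ᴵ I k))

-- The poset ⪯: reflexive transitive closure of ⋖ (intervals are distinct,
-- so we identify them with their indices).
_⊢_⪯_ : {t : ℕ} → (Fin t → Interval) → Fin t → Fin t → Set
I ⊢ i ⪯ j = Star (Cover I) i j

Maximal : {t : ℕ} → (Fin t → Interval) → Fin t → Set
Maximal {t} I i = ∀ (j : Fin t) → I ⊢ i ⪯ j → j ≡ i

Minimal : {t : ℕ} → (Fin t → Interval) → Fin t → Set
Minimal {t} I i = ∀ (j : Fin t) → I ⊢ j ⪯ i → j ≡ i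

Symmetric : Interval → Set
Symmetric (a , b) = (a < 0ℤ) × (b ≡ - a)

-- The only intervals of the form [ā,a] are symmetric about 0, so any two of them are nested;
-- non-nesting therefore allows at most one. Every other interval lies in [1,n], so its left
-- endpoint exceeds that of the symmetric interval S. A zig-zag triple cannot have S in the
-- middle: the left endpoints would have to be monotone through S. Hence S cannot meet both an
-- earlier and a later interval; if it meets an earlier one there is no cover S ⋖ J and S is
-- maximal, and otherwise there is no cover J ⋖ S and S is minimal.
module Submission where

open import Defs
open import Data.Nat using (ℕ; z<s)
open import Data.Fin using (Fin) renaming (_<_ to _<ᶠ_)
open import Data.Fin.Properties using (any?) renaming (_≟_ to _≟ᶠ_; _<?_ to _<ᶠ?_; <⇒≢ to <ᶠ⇒≢)
open import Data.Integer using (+_; -_; _≤_; _<_; 0ℤ; +<+)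
open import Data.Integer.Properties
  using (≤-total; ≤-trans; ≤-refl; <-≤-trans; <⇒≤; <⇒≢; <-asym; <-trans; neg-mono-≤; neg-mono-<; neg-involutive; _≤?_)
open import Data.Product using (_×_; _,_; proj₁; proj₂)
open import Data.Sum using (_⊎_; inj₁; inj₂)
open import Data.Empty using (⊥; ⊥-elim)
open import Function using (flip; id)
open import Relation.Nullary using (¬_; yes; no)
open import Relation.Nullary.Decidable using (_×-dec_)
open import Relation.Binary.PropositionalEquality using (_≡_; _≢_; refl; sym)
open import Relation.Binary.Construct.Closure.ReflexiveTransitive using (ε; _◅_; reverse)

positive : ∀ {c} → + 1 ≤ c → 0ℤ < c
positive 1≤c = <-≤-trans (+<+ z<s) 1≤c

BCInterval⇒positive⊎symmetric : ∀ {n I} → BCInterval n I →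
  ((+ 1 ≤ proj₁ I) × (proj₁ I ≤ proj₂ I)) ⊎ Symmetric I
BCInterval⇒positive⊎symmetric (inj₁ (_ , _ , 1≤a , a≤b , _ , refl)) = inj₁ (1≤a , a≤b)
BCInterval⇒positive⊎symmetric (inj₂ (a , 1≤a , _ , refl)) =
  inj₂ (neg-mono-< (positive 1≤a) , sym (neg-involutive a))

symmetric-⊆ : ∀ {I J} → Symmetric I → Symmetric J → proj₁ J ≤ proj₁ I → I ⊆ᴵ J
symmetric-⊆ {a , _} {c , _} (_ , refl) (_ , refl) c≤a x (x≢0 , a≤x , x≤-a) =
  x≢0 , ≤-trans c≤a a≤x , ≤-trans x≤-a (neg-mono-≤ c≤a)

Meets⇒left≤right : ∀ {I J} → Meets I J → proj₁ I ≤ proj₂ J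
Meets⇒left≤right (_ , (_ , cᵢ≤x , _) , (_ , _ , x≤dⱼ)) = ≤-trans cᵢ≤x x≤dⱼ

Cover⇒Meets : ∀ {t} {I : Fin t → Interval} {i j} → Cover I i j → Meets (I i) (I j)
Cover⇒Meets (_ , x , x∈Iᵢ , x∈Iⱼ , _) = x , x∈Iᵢ , x∈Iⱼ

no-cover-from⇒maximal : ∀ {t} {I : Fin t → Interval} {i} → (∀ j → ¬ Cover I i j) → Maximal I i
no-cover-from⇒maximal no-cover _ ε = refl
no-cover-from⇒maximal no-cover _ (i⋖k ◅ _) = ⊥-elim (no-cover _ i⋖k)

no-cover-into⇒minimal : ∀ {t} {I : Fin t → Interval} {i} → (∀ j → ¬ Cover I j i) → Minimal I i
no-cover-into⇒minimal {I = I} {i} no-cover j j⪯i with reverse {U = flip (Cover I)} id j⪯i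
... | ε = refl
... | k⋖i ◅ _ = ⊥-elim (no-cover _ k⋖i)

module _ {t} {I : Fin t → Interval} where

  symmetric-unique : (∀ i j → i ≢ j → ¬ (I i ⊆ᴵ I j)) →
    ∀ i j → Symmetric (I i) → Symmetric (I j) → i ≡ j
  symmetric-unique non-nesting i j symᵢ symⱼ with i ≟ᶠ j
  ... | yes i≡j = i≡j
  ... | no i≢j with ≤-total (proj₁ (I i)) (proj₁ (I j))
  ... | inj₁ cᵢ≤cⱼ = ⊥-elim (non-nesting j i (λ j≡i → i≢j (sym j≡i)) (symmetric-⊆ symⱼ symᵢ cᵢ≤cⱼ))
  ... | inj₂ cⱼ≤cᵢ = ⊥-elim (non-nesting i j i≢j (symmetric-⊆ symᵢ symⱼ cⱼ≤cᵢ))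

  zigzag-no-valley : ZigZag I → ∀ {i j k} → i <ᶠ j → j <ᶠ k →
    Meets (I i) (I j) → Meets (I j) (I k) →
    proj₁ (I j) < proj₁ (I i) → proj₁ (I j) < proj₁ (I k) → ⊥
  zigzag-no-valley (_ , _ , zigzag) i<j j<k mᵢⱼ mⱼₖ cⱼ<cᵢ cⱼ<cₖ with zigzag _ _ _ i<j j<k mᵢⱼ mⱼₖ
  ... | inj₁ (cᵢ<cⱼ , _) = <-asym cᵢ<cⱼ cⱼ<cᵢ
  ... | inj₂ (_ , cₖ<cⱼ) = <-asym cₖ<cⱼ cⱼ<cₖ

  module _ {n} (network : BCZigZag n I) {s} (symₛ : Symmetric (I s)) where

    other-positive : ∀ k → k ≢ s → (+ 1 ≤ proj₁ (I k)) × (proj₁ (I k) ≤ proj₂ (I k))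
    other-positive k k≢s with BCInterval⇒positive⊎symmetric (proj₁ network k)
    ... | inj₁ pos = pos
    ... | inj₂ symₖ = ⊥-elim (k≢s (symmetric-unique (proj₁ (proj₂ (proj₂ network))) k s symₖ symₛ))

    symmetric-leftmost : ∀ k → k ≢ s → proj₁ (I s) < proj₁ (I k)
    symmetric-leftmost k k≢s = <-trans (proj₁ symₛ) (positive (proj₁ (other-positive k k≢s)))

    meets-earlier⇒maximal : ∀ j → j <ᶠ s → proj₁ (I j) ≤ proj₂ (I s) → Maximal I s
    meets-earlier⇒maximal j j<s cⱼ≤dₛ = no-cover-from⇒maximal λ k s⋖k →
      zigzag-no-valley (proj₂ network) j<s (proj₁ s⋖k) mⱼₛ (Cover⇒Meets s⋖k)
        (symmetric-leftmost j j≢s)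
        (symmetric-leftmost k λ k≡s → <ᶠ⇒≢ (proj₁ s⋖k) (sym k≡s))
      where
      j≢s = <ᶠ⇒≢ j<s
      cⱼ≢0 = λ cⱼ≡0 → <⇒≢ (positive (proj₁ (other-positive j j≢s))) (sym cⱼ≡0)
      mⱼₛ : Meets (I j) (I s)
      mⱼₛ = proj₁ (I j) , (cⱼ≢0 , ≤-refl , proj₂ (other-positive j j≢s)) ,
            (cⱼ≢0 , <⇒≤ (symmetric-leftmost j j≢s) , cⱼ≤dₛ)

    symmetric-maximal⊎minimal : Maximal I s ⊎ Minimal I s
    symmetric-maximal⊎minimal with any? (λ j → (j <ᶠ? s) ×-dec (proj₁ (I j) ≤? proj₂ (I s)))
    ... | yes (j , j<s , cⱼ≤dₛ) = inj₁ (meets-earlier⇒maximal j j<s cⱼ≤dₛ)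
    ... | no none = inj₂ (no-cover-into⇒minimal λ k k⋖s →
            none (k , proj₁ k⋖s , Meets⇒left≤right (Cover⇒Meets k⋖s)))

proposition5p15 : (n t : ℕ) (I : Fin t → Interval) → BCZigZag n I →
    (∀ i j → Symmetric (I i) → Symmetric (I j) → i ≡ j)
    × (∀ i → Symmetric (I i) → Maximal I i ⊎ Minimal I i)
proposition5p15 n t I network@(_ , _ , non-nesting , _) =
  symmetric-unique non-nesting ,
  λ s symₛ → symmetric-maximal⊎minimal network symₛ
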